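{- Let $r\in\mathbb{N}\cup\{\infty\}$. Every subdivision of a wheel with an $r$-explicit generating set contains (as a subgraph) a subdivision of a wheel that is $r$-bounded.
   Context: All graphs are simple and weighted: every edge has a positive integer length; the length of a path or cycle is the sum of the lengths of its edges, and subgraphs inherit edge lengths. A wheel is obtained from a cycle (with at least three vertices) by adding a center vertex adjacent to all vertices of the cycle. A subdivision of a wheel is obtained by replacing its edges by internally disjoint paths; it comes with its center (for $K_4$, a chosen branch vertex). The rim is the subdivided original cycle (the unique cycle not containing the center). The pieces of a wheel are its triangles containing the center, and the pieces of a subdivision are the cycles obtained by subdividing these. A subdivision of a wheel is $r$-bounded if all its pieces have length at most $r$. It has an $r$-explicit generating set if either all its pieces have length at most $r$, or all its pieces except one have length at most $r$ and the rim has length at most $r$. -}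

module Defs where

open import Level using (0ℓ)
open import Data.Nat using (ℕ; zero; suc; _+_; _≤_; _<_)
open import Data.Nat.DivMod using (_mod_)
open import Data.Fin using (Fin; toℕ)
open import Data.List using (List; []; _∷_; _++_; map; allFin)
open import Data.Nat.ListAction using (sum)
open import Data.List.Membership.Propositional using (_∈_)
open import Data.List.Relation.Unary.All using (All)
open import Data.List.Relation.Unary.Unique.Propositional using (Unique)
open import Data.Product using (Σ; ∃; ∃-syntax; _×_; _,_)
open import Data.Sum using (_⊎_; inj₁; inj₂)
open import Data.Unit using (⊤)
open import Relation.Binary.PropositionalEquality using (_≡_; _≢_)

data ℕ∞ : Set where
  fin : ℕ → ℕ∞
  ∞   : ℕ∞

_≤∞_ : ℕ → ℕ∞ → Set
m ≤∞ fin r = m ≤ r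
m ≤∞ ∞     = ⊤

-- A simple graph with positive integer edge lengths: u v adjacent iff ℓ u v > 0,
-- and then ℓ u v is the length of the edge uv.
record WGraph : Set₁ where
  field
    V      : Set
    ℓ      : V → V → ℕ
    ℓ-sym  : ∀ u v → ℓ u v ≡ ℓ v u
    ℓ-loop : ∀ v → ℓ v v ≡ 0

pairs : {A : Set} → List A → List (A × A)
pairs (u ∷ v ∷ rest) = (u , v) ∷ pairs (v ∷ rest)
pairs _              = []

-- The paths of a subdivided wheel with k spokes: spokes and rim segments.
PathIdx : ℕ → Set
PathIdx k = Fin k ⊎ Fin k

next : ∀ {m} → Fin (3 + m) → Fin (3 + m)
next {m} i = suc (toℕ i) mod (3 + m)

module _ (G : WGraph) where
  open WGraph G

  walkLen : List V → ℕ
  walkLen p = sum (map (λ e → ℓ (Data.Product.proj₁ e) (Data.Product.proj₂ e)) (pairs p))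

  IsPath : List V → Set
  IsPath p = All (λ e → 0 < ℓ (Data.Product.proj₁ e) (Data.Product.proj₂ e)) (pairs p) × Unique p

  pathStart : ∀ {m} → V → (Fin (3 + m) → V) → PathIdx (3 + m) → V
  pathStart c b (inj₁ i) = c
  pathStart c b (inj₂ i) = b i

  pathEnd : ∀ {m} → (Fin (3 + m) → V) → PathIdx (3 + m) → V
  pathEnd b (inj₁ i) = b i
  pathEnd b (inj₂ i) = b (next i)

  fullPath : ∀ {m} → V → (Fin (3 + m) → V) → (PathIdx (3 + m) → List V) → PathIdx (3 + m) → List V
  fullPath c b inn k = pathStart c b k ∷ inn k ++ pathEnd b k ∷ []

  -- Spoke i is a path from the center to branch vertex b i,
  -- rim segment i is a path from b i to b (next i); `inner` gives the internal
  -- vertices of each of these paths.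
  record WheelSub (m : ℕ) : Set where
    field
      center : V
      branch : Fin (3 + m) → V
      inner  : PathIdx (3 + m) → List V

    field
      center-branch : ∀ i → center ≢ branch i
      branch-inj    : ∀ i j → branch i ≡ branch j → i ≡ j
      paths         : ∀ k → IsPath (fullPath center branch inner k)
      inner-center  : ∀ k x → x ∈ inner k → x ≢ center
      inner-branch  : ∀ k x j → x ∈ inner k → x ≢ branch j
      inner-disj    : ∀ k k' x → x ∈ inner k → x ∈ inner k' → k ≡ k'

    full : PathIdx (3 + m) → List V
    full = fullPath center branch inner

    spokeLen : Fin (3 + m) → ℕ
    spokeLen i = walkLen (full (inj₁ i))

    rimSegLen : Fin (3 + m) → ℕ
    rimSegLen i = walkLen (full (inj₂ i))

    -- length of the piece (subdivided triangle) through spokes i, next i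
    pieceLen : Fin (3 + m) → ℕ
    pieceLen i = spokeLen i + rimSegLen i + spokeLen (next i)

    rimLen : ℕ
    rimLen = sum (map rimSegLen (allFin (3 + m)))

    HasEdge : V → V → Set
    HasEdge u v = ∃[ k ] ((u , v) ∈ pairs (full k) ⊎ (v , u) ∈ pairs (full k))

    HasVertex : V → Set
    HasVertex x = ∃[ k ] (x ∈ full k)

  open WheelSub

  Bounded : ∀ {m} → ℕ∞ → WheelSub m → Set
  Bounded r W = ∀ i → pieceLen W i ≤∞ r

  ExplicitGen : ∀ {m} → ℕ∞ → WheelSub m → Set
  ExplicitGen r W =
    (∀ i → pieceLen W i ≤∞ r)
    ⊎ (∃[ j ] ((∀ i → i ≢ j → pieceLen W i ≤∞ r) × rimLen W ≤∞ r))

  -- W' is a subgraph of W (edge lengths are inherited from G)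
  _⊆W_ : ∀ {m m'} → WheelSub m' → WheelSub m → Set
  W' ⊆W W = (∀ x → HasVertex W' x → HasVertex W x)
          × (∀ u v → HasEdge W' u v → HasEdge W u v)

module Submission where

-- If all pieces of W are r-bounded, W itself is the answer.  Otherwise all
-- pieces except one, piece j, are r-bounded and so is the rim.  Three
-- operations on subdivided wheels produce subwheels W' ⊆ W:
--   * rotation renumbers the branch vertices cyclically; pieces are
--     permuted and the rim is unchanged, so piece j can be moved to index 0;
--   * contraction forgets spoke 1 of a wheel with at least four spokes and
--     merges rim segments 0 and 1; pieces 2, 3, … survive unchanged, pieces
--     0 and 1 are replaced by one new piece 0, and the rim is unchanged;
--   * recentring views a subdivided K₄ from its branch vertex b₂; its pieces
--     are the two old pieces through b₂ and the old rim.
-- Contracting down to K₄ preserves "every piece except piece 0 and the rim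
-- are r-bounded"; recentring then discards the long piece 0 and turns the
-- short rim into a piece, which yields an r-bounded subdivided wheel.

open import Defs
open import Data.Empty using (⊥; ⊥-elim)
open import Data.Fin using (Fin; zero; suc; toℕ; inject₁; fromℕ)
open import Data.Fin.Properties using (toℕ-injective; toℕ-fromℕ<; toℕ-inject₁; toℕ-fromℕ; toℕ<n)
  renaming (suc-injective to Fin-suc-injective)
open import Data.Fin.Relation.Unary.Top using (view; ‵fromℕ; ‵inj₁)
open import Data.List using (List; []; _∷_; _++_; map; reverse; _∷ʳ_; tabulate)
open import Data.List.Properties using (++-assoc; unfold-reverse; map-++; reverse-map; reverse-++; map-cong; map-∘; map-tabulate; tabulate-cong)
open import Data.List.Membership.Propositional using (_∈_)
open import Data.List.Membership.Propositional.Properties using (∈-map⁻; ∈-++⁻; ∈-++⁺ˡ)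
open import Data.List.Relation.Binary.Permutation.Propositional using (↭-sym; ↭⇒↭ₛ)
open import Data.List.Relation.Binary.Permutation.Propositional.Properties using (↭-reverse)
open import Data.List.Relation.Binary.Permutation.Setoid.Properties using (Unique-resp-↭)
open import Data.List.Relation.Unary.All as All using (All)
import Data.List.Relation.Unary.All.Properties as All
open import Data.List.Relation.Unary.Any using (here; there)
import Data.List.Relation.Unary.Any.Properties as Any
open import Data.List.Relation.Unary.AllPairs using ([]; _∷_)
open import Data.List.Relation.Unary.Unique.Propositional using (Unique)
import Data.List.Relation.Unary.Unique.Propositional.Properties as Unique
open import Data.Nat using (ℕ; zero; suc; _+_; _<_; s≤s)
open import Data.Nat.DivMod using (_%_; n%n≡0; m<n⇒m%n≡m; m%n<n)
open import Data.Nat.ListAction using (sum)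
open import Data.Nat.ListAction.Properties using (sum-++; sum-↭)
open import Data.Nat.Properties using (+-assoc; +-comm; +-identityʳ; suc-injective)
open import Data.Nat.Tactic.RingSolver using (solve-∀)
open import Data.Product using (Σ; ∃-syntax; _×_; _,_; swap)
open import Data.Sum using (_⊎_; inj₁; inj₂)
import Data.Sum as Sum
open import Data.Sum.Properties using (inj₁-injective; inj₂-injective)
open import Function using (_∘_)
open import Relation.Binary.PropositionalEquality
  using (_≡_; _≢_; refl; sym; trans; cong; cong₂; subst; setoid; module ≡-Reasoning)

open WheelSub

module _ {A : Set} where

  pairs-++ : ∀ (xs : List A) y ys → pairs (xs ++ y ∷ ys) ≡ pairs (xs ++ y ∷ []) ++ pairs (y ∷ ys)
  pairs-++ []            y ys = refl
  pairs-++ (x ∷ [])      y ys = refl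
  pairs-++ (x ∷ x' ∷ xs) y ys = cong ((x , x') ∷_) (pairs-++ (x' ∷ xs) y ys)

  pairs-reverse : ∀ (p : List A) → pairs (reverse p) ≡ map swap (reverse (pairs p))
  pairs-reverse []          = refl
  pairs-reverse (a ∷ [])    = refl
  pairs-reverse (a ∷ b ∷ q) = begin
      pairs (reverse (a ∷ b ∷ q))                      ≡⟨ cong pairs reverse-∷∷ ⟩
      pairs (reverse q ++ b ∷ a ∷ [])                  ≡⟨ pairs-++ (reverse q) b (a ∷ []) ⟩
      pairs (reverse q ++ b ∷ []) ++ (b , a) ∷ []      ≡⟨ cong (λ z → pairs z ++ (b , a) ∷ []) (sym (unfold-reverse b q)) ⟩
      pairs (reverse (b ∷ q)) ++ (b , a) ∷ []          ≡⟨ cong (_++ (b , a) ∷ []) (pairs-reverse (b ∷ q)) ⟩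
      map swap (reverse (pairs (b ∷ q))) ++ map swap ((a , b) ∷ [])  ≡⟨ sym (map-++ swap (reverse (pairs (b ∷ q))) _) ⟩
      map swap (reverse (pairs (b ∷ q)) ∷ʳ (a , b))    ≡⟨ cong (map swap) (sym (unfold-reverse (a , b) (pairs (b ∷ q)))) ⟩
      map swap (reverse (pairs (a ∷ b ∷ q)))           ∎
    where
      open ≡-Reasoning
      reverse-∷∷ : reverse (a ∷ b ∷ q) ≡ reverse q ++ b ∷ a ∷ []
      reverse-∷∷ = begin
        reverse (a ∷ b ∷ q)        ≡⟨ unfold-reverse a (b ∷ q) ⟩
        reverse (b ∷ q) ∷ʳ a       ≡⟨ cong (_∷ʳ a) (unfold-reverse b q) ⟩
        (reverse q ∷ʳ b) ∷ʳ a      ≡⟨ ++-assoc (reverse q) (b ∷ []) (a ∷ []) ⟩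
        reverse q ++ b ∷ a ∷ []    ∎

  ∈-pairs-reverse : ∀ {u v : A} p → (u , v) ∈ pairs (reverse p) → (v , u) ∈ pairs p
  ∈-pairs-reverse {u} {v} p uv∈ with ∈-map⁻ swap (subst ((u , v) ∈_) (pairs-reverse p) uv∈)
  ... | _ , vu∈ , refl = Any.reverse⁻ vu∈

  Unique-reverse : ∀ (xs : List A) → Unique xs → Unique (reverse xs)
  Unique-reverse xs = Unique-resp-↭ (setoid A) (↭⇒↭ₛ (↭-sym (↭-reverse xs)))

  Unique-++⁻ˡ : ∀ (xs ys : List A) → Unique (xs ++ ys) → Unique xs
  Unique-++⁻ˡ []       ys u          = []
  Unique-++⁻ˡ (x ∷ xs) ys (x∉ ∷ u) = All.++⁻ˡ xs x∉ ∷ Unique-++⁻ˡ xs ys u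

  reverse-path : ∀ (a : A) xs b → reverse (a ∷ xs ++ b ∷ []) ≡ b ∷ reverse xs ++ a ∷ []
  reverse-path a xs b = begin
      reverse (a ∷ xs ++ b ∷ [])     ≡⟨ unfold-reverse a (xs ++ b ∷ []) ⟩
      reverse (xs ∷ʳ b) ∷ʳ a         ≡⟨ cong (_∷ʳ a) (reverse-++ xs (b ∷ [])) ⟩
      (b ∷ reverse xs) ∷ʳ a          ∎
    where open ≡-Reasoning

next-inject₁ : ∀ {m} (k : Fin (2 + m)) → next {m} (inject₁ k) ≡ suc k
next-inject₁ {m} k = toℕ-injective (begin
    toℕ (next {m} (inject₁ k))        ≡⟨ toℕ-fromℕ< (m%n<n (suc (toℕ (inject₁ k))) (3 + m)) ⟩
    suc (toℕ (inject₁ k)) % (3 + m)   ≡⟨ cong (λ z → suc z % (3 + m)) (toℕ-inject₁ k) ⟩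
    suc (toℕ k) % (3 + m)             ≡⟨ m<n⇒m%n≡m (s≤s (toℕ<n k)) ⟩
    suc (toℕ k)                       ∎)
  where open ≡-Reasoning

next-fromℕ : ∀ {m} → next {m} (fromℕ (2 + m)) ≡ zero
next-fromℕ {m} = toℕ-injective (begin
    toℕ (next {m} (fromℕ (2 + m)))        ≡⟨ toℕ-fromℕ< (m%n<n (suc (toℕ (fromℕ (2 + m)))) (3 + m)) ⟩
    suc (toℕ (fromℕ (2 + m))) % (3 + m)   ≡⟨ cong (λ z → suc z % (3 + m)) (toℕ-fromℕ (2 + m)) ⟩
    (3 + m) % (3 + m)                     ≡⟨ n%n≡0 (3 + m) ⟩
    0                                     ∎)
  where open ≡-Reasoning

next-injective : ∀ {m} (i j : Fin (3 + m)) → next {m} i ≡ next j → i ≡ j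
next-injective i j eq with view i | view j
... | ‵fromℕ     | ‵fromℕ      = refl
... | ‵fromℕ     | ‵inj₁ {i = k} _ with () ← trans (sym next-fromℕ) (trans eq (next-inject₁ k))
... | ‵inj₁ {i = k} _ | ‵fromℕ with () ← trans (sym (next-inject₁ k)) (trans eq next-fromℕ)
... | ‵inj₁ {i = k} _ | ‵inj₁ {i = k'} _ =
  cong inject₁ (Fin-suc-injective (trans (sym (next-inject₁ k)) (trans eq (next-inject₁ k'))))

∑ : ∀ {n} → (Fin n → ℕ) → ℕ
∑ f = sum (tabulate f)

∑-cong : ∀ {n} {f g : Fin n → ℕ} → (∀ i → f i ≡ g i) → ∑ f ≡ ∑ g
∑-cong f≗g = cong sum (tabulate-cong f≗g)

∑-last : ∀ {n} (f : Fin (suc n) → ℕ) → ∑ f ≡ ∑ (f ∘ inject₁) + f (fromℕ n)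
∑-last {zero}  f = +-identityʳ (f zero)
∑-last {suc n} f = begin
    f zero + ∑ (f ∘ suc)                                  ≡⟨ cong (f zero +_) (∑-last (f ∘ suc)) ⟩
    f zero + (∑ (f ∘ suc ∘ inject₁) + f (suc (fromℕ n)))  ≡⟨ sym (+-assoc (f zero) _ _) ⟩
    f zero + ∑ (f ∘ suc ∘ inject₁) + f (suc (fromℕ n))    ∎
  where open ≡-Reasoning

∑-next : ∀ {m} (f : Fin (3 + m) → ℕ) → ∑ (f ∘ next {m}) ≡ ∑ f
∑-next {m} f = begin
    ∑ (f ∘ next)                                          ≡⟨ ∑-last (f ∘ next) ⟩
    ∑ (f ∘ next ∘ inject₁) + f (next (fromℕ (2 + m)))     ≡⟨ cong₂ _+_ (∑-cong (cong f ∘ next-inject₁)) (cong f next-fromℕ) ⟩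
    ∑ (f ∘ suc) + f zero                                  ≡⟨ +-comm (∑ (f ∘ suc)) (f zero) ⟩
    ∑ f                                                   ∎
  where open ≡-Reasoning

rimLen-∑ : ∀ {G m} (W : WheelSub G m) → rimLen W ≡ ∑ (rimSegLen W)
rimLen-∑ W = cong sum (map-tabulate (λ i → i) (rimSegLen W))

module Paths (G : WGraph) where
  open WGraph G

  edgeLen : V × V → ℕ
  edgeLen (u , v) = ℓ u v

  walkLen-++ : ∀ xs y ys → walkLen G (xs ++ y ∷ ys) ≡ walkLen G (xs ++ y ∷ []) + walkLen G (y ∷ ys)
  walkLen-++ xs y ys = begin
      sum (map edgeLen (pairs (xs ++ y ∷ ys)))                              ≡⟨ cong (sum ∘ map edgeLen) (pairs-++ xs y ys) ⟩
      sum (map edgeLen (pairs (xs ++ y ∷ []) ++ pairs (y ∷ ys)))            ≡⟨ cong sum (map-++ edgeLen (pairs (xs ++ y ∷ [])) _) ⟩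
      sum (map edgeLen (pairs (xs ++ y ∷ [])) ++ map edgeLen (pairs (y ∷ ys)))  ≡⟨ sum-++ (map edgeLen (pairs (xs ++ y ∷ []))) _ ⟩
      walkLen G (xs ++ y ∷ []) + walkLen G (y ∷ ys)                        ∎
    where open ≡-Reasoning

  -- Edge lengths are symmetric, so reversing a walk keeps its length.
  walkLen-reverse : ∀ p → walkLen G (reverse p) ≡ walkLen G p
  walkLen-reverse p = begin
      sum (map edgeLen (pairs (reverse p)))              ≡⟨ cong (sum ∘ map edgeLen) (pairs-reverse p) ⟩
      sum (map edgeLen (map swap (reverse (pairs p))))   ≡⟨ cong sum (sym (map-∘ (reverse (pairs p)))) ⟩
      sum (map (edgeLen ∘ swap) (reverse (pairs p)))     ≡⟨ cong sum (map-cong (λ (u , v) → ℓ-sym v u) (reverse (pairs p))) ⟩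
      sum (map edgeLen (reverse (pairs p)))              ≡⟨ cong sum (reverse-map edgeLen (pairs p)) ⟩
      sum (reverse (map edgeLen (pairs p)))              ≡⟨ sum-↭ (↭-reverse (map edgeLen (pairs p))) ⟩
      walkLen G p                                        ∎
    where open ≡-Reasoning

  IsPath-reverse : ∀ p → IsPath G p → IsPath G (reverse p)
  IsPath-reverse p (adjacent , unique) =
    All.tabulate (λ {(u , v)} uv∈ → subst (0 <_) (ℓ-sym v u) (All.lookup adjacent (∈-pairs-reverse p uv∈))) ,
    Unique-reverse p unique

  IsPath-join : ∀ xs y ys → IsPath G (xs ++ y ∷ []) → IsPath G (y ∷ ys)
    → (∀ x → x ∈ xs → x ∈ y ∷ ys → ⊥) → IsPath G (xs ++ y ∷ ys)
  IsPath-join xs y ys (adj₁ , u₁) (adj₂ , u₂) disjoint =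
    subst (All (λ (u , v) → 0 < ℓ u v)) (sym (pairs-++ xs y ys)) (All.++⁺ adj₁ adj₂) ,
    Unique.++⁺ (Unique-++⁻ˡ xs (y ∷ []) u₁) u₂ (λ (x∈xs , x∈yys) → disjoint _ x∈xs x∈yys)

⊆W-refl : ∀ {G m} (W : WheelSub G m) → _⊆W_ G W W
⊆W-refl W = (λ x x∈ → x∈) , (λ u v uv∈ → uv∈)

⊆W-trans : ∀ {G m m' m''} (W'' : WheelSub G m'') (W' : WheelSub G m') (W : WheelSub G m)
  → _⊆W_ G W'' W' → _⊆W_ G W' W → _⊆W_ G W'' W
⊆W-trans W'' W' W (vert₁ , edge₁) (vert₂ , edge₂) =
  (λ x x∈ → vert₂ x (vert₁ x x∈)) , (λ u v uv∈ → edge₂ u v (edge₁ u v uv∈))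

⊆W-by-paths : ∀ {G m m'} (W' : WheelSub G m') (W : WheelSub G m)
  → (∀ k → ∃[ k₀ ] (full W' k ≡ full W k₀ ⊎ full W' k ≡ reverse (full W k₀)))
  → _⊆W_ G W' W
⊆W-by-paths W' W same = vertices , edges
  where
    vertices : ∀ x → HasVertex W' x → HasVertex W x
    vertices x (k , x∈) with same k
    ... | k₀ , inj₁ eq = k₀ , subst (x ∈_) eq x∈
    ... | k₀ , inj₂ eq = k₀ , Any.reverse⁻ (subst (x ∈_) eq x∈)

    edge : ∀ k u v → (u , v) ∈ pairs (full W' k) → HasEdge W u v
    edge k u v uv∈ with same k
    ... | k₀ , inj₁ eq = k₀ , inj₁ (subst (λ p → (u , v) ∈ pairs p) eq uv∈)
    ... | k₀ , inj₂ eq = k₀ , inj₂ (∈-pairs-reverse (full W k₀) (subst (λ p → (u , v) ∈ pairs p) eq uv∈))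

    edges : ∀ u v → HasEdge W' u v → HasEdge W u v
    edges u v (k , inj₁ uv∈) = edge k u v uv∈
    edges u v (k , inj₂ vu∈) with edge k v u vu∈
    ... | k₀ , e = k₀ , Sum.swap e

HasBoundedSubwheel : ∀ (r : ℕ∞) (G : WGraph) {m} → WheelSub G m → Set
HasBoundedSubwheel r G {m} W = ∃[ m' ] ∃[ W' ] ((_⊆W_ G {m} {m'} W' W) × Bounded G r W')

HasBoundedSubwheel-⊆ : ∀ {r G m m'} (W' : WheelSub G m') (W : WheelSub G m)
  → _⊆W_ G W' W → HasBoundedSubwheel r G W' → HasBoundedSubwheel r G W
HasBoundedSubwheel-⊆ W' W W'⊆W (_ , W'' , W''⊆W' , bounded) =
  _ , W'' , ⊆W-trans W'' W' W W''⊆W' W'⊆W , bounded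

nextPath : ∀ {m} → PathIdx (3 + m) → PathIdx (3 + m)
nextPath = Sum.map next next

nextPath-injective : ∀ {m} (k k' : PathIdx (3 + m)) → nextPath k ≡ nextPath k' → k ≡ k'
nextPath-injective (inj₁ i) (inj₁ j) eq = cong inj₁ (next-injective i j (inj₁-injective eq))
nextPath-injective (inj₂ i) (inj₂ j) eq = cong inj₂ (next-injective i j (inj₂-injective eq))
nextPath-injective (inj₁ i) (inj₂ j) ()
nextPath-injective (inj₂ i) (inj₁ j) ()

module _ {G : WGraph} {m : ℕ} (W : WheelSub G m) where

  -- The same subdivided wheel with branch vertex i renamed to i - 1; its
  -- piece i is the piece next i of W (definitionally).
  rotate : WheelSub G m
  rotate .center                = center W
  rotate .branch                = branch W ∘ next
  rotate .inner                 = inner W ∘ nextPath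
  rotate .center-branch i       = center-branch W (next i)
  rotate .branch-inj i j eq     = next-injective i j (branch-inj W _ _ eq)
  rotate .paths (inj₁ i)        = paths W (inj₁ (next i))
  rotate .paths (inj₂ i)        = paths W (inj₂ (next i))
  rotate .inner-center k        = inner-center W (nextPath k)
  rotate .inner-branch k x j    = inner-branch W (nextPath k) x (next j)
  rotate .inner-disj k k' x x∈ x∈' = nextPath-injective k k' (inner-disj W (nextPath k) (nextPath k') x x∈ x∈')

  rotate-full : ∀ k → full rotate k ≡ full W (nextPath k)
  rotate-full (inj₁ i) = refl
  rotate-full (inj₂ i) = refl

  rotate-⊆ : _⊆W_ G rotate W
  rotate-⊆ = ⊆W-by-paths rotate W (λ k → nextPath k , inj₁ (rotate-full k))

  rotate-rim : rimLen rotate ≡ rimLen W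
  rotate-rim = begin
      rimLen rotate               ≡⟨ rimLen-∑ rotate ⟩
      ∑ (rimSegLen W ∘ next)      ≡⟨ ∑-next (rimSegLen W) ⟩
      ∑ (rimSegLen W)             ≡⟨ rimLen-∑ W ⟨
      rimLen W                    ∎
    where open ≡-Reasoning

-- Contraction: the branch vertices of the contracted wheel are those of W
-- except b₁, in their cyclic order.
keep : ∀ {m} → Fin (3 + m) → Fin (3 + suc m)
keep zero    = zero
keep (suc i) = suc (suc i)

keep-injective : ∀ {m} (i j : Fin (3 + m)) → keep i ≡ keep j → i ≡ j
keep-injective zero    zero    eq   = refl
keep-injective (suc i) (suc j) refl = refl

keep≢1 : ∀ {m} (j : Fin (3 + m)) → keep j ≢ suc zero
keep≢1 zero    ()
keep≢1 (suc j) ()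

next-keep : ∀ {m} (i : Fin (2 + m)) → next {suc m} (suc (suc i)) ≡ keep (next {m} (suc i))
next-keep {m} i with view i
... | ‵fromℕ         = trans (next-fromℕ {suc m}) (sym (cong keep (next-fromℕ {m})))
... | ‵inj₁ {i = k} _ = trans (next-inject₁ {suc m} (suc (suc k))) (sym (cong keep (next-inject₁ {m} (suc k))))

-- The path of the contracted wheel containing the interior of a path of W;
-- rim segments 0 and 1 both go to the merged segment 0.  (Spoke 1 is
-- discarded; its image is irrelevant.)
keepPath : ∀ {m} → PathIdx (3 + suc m) → PathIdx (3 + m)
keepPath (inj₁ zero)          = inj₁ zero
keepPath (inj₁ (suc zero))    = inj₁ zero
keepPath (inj₁ (suc (suc i))) = inj₁ (suc i)
keepPath (inj₂ zero)          = inj₂ zero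
keepPath (inj₂ (suc zero))    = inj₂ zero
keepPath (inj₂ (suc (suc i))) = inj₂ (suc i)

module _ {G : WGraph} {m : ℕ} (W : WheelSub G (suc m)) where
  open WGraph G
  open Paths G

  private
    b : Fin (3 + suc m) → V
    b = branch W
    I : PathIdx (3 + suc m) → List V
    I = inner W
    b₂ : V
    b₂ = b (suc (suc zero))

  contractInner : PathIdx (3 + m) → List V
  contractInner (inj₁ i)       = I (inj₁ (keep i))
  contractInner (inj₂ zero)    = I (inj₂ zero) ++ b (suc zero) ∷ I (inj₂ (suc zero))
  contractInner (inj₂ (suc i)) = I (inj₂ (suc (suc i)))

  contractInner-origin : ∀ k x → x ∈ contractInner k
    → (∃[ k₀ ] (x ∈ I k₀ × keepPath k₀ ≡ k)) ⊎ (x ≡ b (suc zero) × k ≡ inj₂ zero)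
  contractInner-origin (inj₁ zero)    x x∈ = inj₁ (inj₁ zero , x∈ , refl)
  contractInner-origin (inj₁ (suc i)) x x∈ = inj₁ (inj₁ (suc (suc i)) , x∈ , refl)
  contractInner-origin (inj₂ (suc i)) x x∈ = inj₁ (inj₂ (suc (suc i)) , x∈ , refl)
  contractInner-origin (inj₂ zero)    x x∈ with ∈-++⁻ (I (inj₂ zero)) x∈
  ... | inj₁ x∈₀         = inj₁ (inj₂ zero , x∈₀ , refl)
  ... | inj₂ (here x≡b₁) = inj₂ (x≡b₁ , refl)
  ... | inj₂ (there x∈₁) = inj₁ (inj₂ (suc zero) , x∈₁ , refl)

  merged-full : fullPath G (center W) (b ∘ keep) contractInner (inj₂ zero)
              ≡ (b zero ∷ I (inj₂ zero)) ++ full W (inj₂ (suc zero))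
  merged-full = cong (b zero ∷_) (++-assoc (I (inj₂ zero)) (b (suc zero) ∷ I (inj₂ (suc zero))) (b₂ ∷ []))

  merged-disjoint : ∀ x → x ∈ b zero ∷ I (inj₂ zero) → x ∈ full W (inj₂ (suc zero)) → ⊥
  merged-disjoint x (here refl) (here eq) with () ← branch-inj W _ _ eq
  merged-disjoint x (here refl) (there x∈) with ∈-++⁻ (I (inj₂ (suc zero))) x∈
  ... | inj₁ x∈₁ = inner-branch W (inj₂ (suc zero)) x zero x∈₁ refl
  ... | inj₂ (here eq) with () ← branch-inj W _ _ eq
  merged-disjoint x (there x∈₀) (here eq) = inner-branch W (inj₂ zero) x (suc zero) x∈₀ eq
  merged-disjoint x (there x∈₀) (there x∈) with ∈-++⁻ (I (inj₂ (suc zero))) x∈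
  ... | inj₁ x∈₁ with () ← inner-disj W (inj₂ zero) (inj₂ (suc zero)) x x∈₀ x∈₁
  ... | inj₂ (here eq) = inner-branch W (inj₂ zero) x (suc (suc zero)) x∈₀ eq

  unmerged-full : ∀ i → fullPath G (center W) (b ∘ keep) contractInner (inj₂ (suc i)) ≡ full W (inj₂ (suc (suc i)))
  unmerged-full i = cong (λ j → b (suc (suc i)) ∷ I (inj₂ (suc (suc i))) ++ b j ∷ []) (sym (next-keep i))

  contract : WheelSub G m
  contract .center = center W
  contract .branch = b ∘ keep
  contract .inner  = contractInner
  contract .center-branch i   = center-branch W (keep i)
  contract .branch-inj i j eq = keep-injective i j (branch-inj W _ _ eq)
  contract .paths (inj₁ i)       = paths W (inj₁ (keep i))
  contract .paths (inj₂ zero)    = subst (IsPath G) (sym merged-full)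
    (IsPath-join (b zero ∷ I (inj₂ zero)) (b (suc zero)) (I (inj₂ (suc zero)) ++ b₂ ∷ [])
      (paths W (inj₂ zero)) (paths W (inj₂ (suc zero))) merged-disjoint)
  contract .paths (inj₂ (suc i)) = subst (IsPath G) (sym (unmerged-full i)) (paths W (inj₂ (suc (suc i))))
  contract .inner-center k x x∈ with contractInner-origin k x x∈
  ... | inj₁ (k₀ , x∈₀ , _) = inner-center W k₀ x x∈₀
  ... | inj₂ (refl , _)     = λ eq → center-branch W (suc zero) (sym eq)
  contract .inner-branch k x j x∈ with contractInner-origin k x x∈
  ... | inj₁ (k₀ , x∈₀ , _) = inner-branch W k₀ x (keep j) x∈₀
  ... | inj₂ (refl , _)     = λ eq → keep≢1 j (sym (branch-inj W _ _ eq))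
  contract .inner-disj k k' x x∈ x∈' with contractInner-origin k x x∈ | contractInner-origin k' x x∈'
  ... | inj₁ (k₀ , x∈₀ , refl) | inj₁ (k₁ , x∈₁ , refl) = cong keepPath (inner-disj W k₀ k₁ x x∈₀ x∈₁)
  ... | inj₁ (k₀ , x∈₀ , _)    | inj₂ (refl , _)        = ⊥-elim (inner-branch W k₀ x (suc zero) x∈₀ refl)
  ... | inj₂ (refl , _)        | inj₁ (k₁ , x∈₁ , _)    = ⊥-elim (inner-branch W k₁ x (suc zero) x∈₁ refl)
  ... | inj₂ (_ , refl)        | inj₂ (_ , refl)        = refl

  contract-⊆ : _⊆W_ G contract W
  contract-⊆ = (λ { x (k , x∈) → vertex k x x∈ })
             , (λ { u v (k , inj₁ uv∈) → let (k₀ , uv∈₀) = edge k _ uv∈ in k₀ , inj₁ uv∈₀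
                  ; u v (k , inj₂ vu∈) → let (k₀ , vu∈₀) = edge k _ vu∈ in k₀ , inj₂ vu∈₀ })
    where
      vertex : ∀ k x → x ∈ full contract k → HasVertex W x
      vertex (inj₁ i)       x x∈ = inj₁ (keep i) , x∈
      vertex (inj₂ (suc i)) x x∈ = inj₂ (suc (suc i)) , subst (x ∈_) (unmerged-full i) x∈
      vertex (inj₂ zero)    x x∈ with ∈-++⁻ (b zero ∷ I (inj₂ zero)) (subst (x ∈_) merged-full x∈)
      ... | inj₁ x∈₀ = inj₂ zero , ∈-++⁺ˡ x∈₀
      ... | inj₂ x∈₁ = inj₂ (suc zero) , x∈₁

      edge : ∀ k e → e ∈ pairs (full contract k) → ∃[ k₀ ] (e ∈ pairs (full W k₀))
      edge (inj₁ i)       e e∈ = inj₁ (keep i) , e∈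
      edge (inj₂ (suc i)) e e∈ = inj₂ (suc (suc i)) , subst (λ p → e ∈ pairs p) (unmerged-full i) e∈
      edge (inj₂ zero)    e e∈
        with ∈-++⁻ (pairs (full W (inj₂ zero)))
               (subst (e ∈_) (trans (cong pairs merged-full) (pairs-++ (b zero ∷ I (inj₂ zero)) (b (suc zero)) _)) e∈)
      ... | inj₁ e∈₀ = inj₂ zero , e∈₀
      ... | inj₂ e∈₁ = inj₂ (suc zero) , e∈₁

  contract-piece : ∀ i → pieceLen contract (suc i) ≡ pieceLen W (suc (suc i))
  contract-piece i = cong₂ _+_ (cong (spokeLen W (suc (suc i)) +_) (cong (walkLen G) (unmerged-full i)))
                               (cong (spokeLen W) (sym (next-keep i)))

  contract-rim : rimLen contract ≡ rimLen W
  contract-rim = begin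
      rimLen contract                                      ≡⟨ rimLen-∑ contract ⟩
      rimSegLen contract zero + ∑ (rimSegLen contract ∘ suc)
        ≡⟨ cong₂ _+_ (trans (cong (walkLen G) merged-full) (walkLen-++ (b zero ∷ I (inj₂ zero)) (b (suc zero)) _))
                     (∑-cong (cong (walkLen G) ∘ unmerged-full)) ⟩
      rimSegLen W zero + rimSegLen W (suc zero) + ∑ (λ i → rimSegLen W (suc (suc i)))   ≡⟨ +-assoc (rimSegLen W zero) _ _ ⟩
      ∑ (rimSegLen W)                                      ≡⟨ rimLen-∑ W ⟨
      rimLen W                                             ∎
    where open ≡-Reasoning

-- Recentring a subdivided K₄ with center c and branch vertices b₀ b₁ b₂ at
-- b₂: the new branch vertices are c, b₀, b₁, and new path k is the old path
-- `recentrePath k`.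
recentrePath : PathIdx 3 → PathIdx 3
recentrePath (inj₁ zero)             = inj₁ (suc (suc zero))
recentrePath (inj₁ (suc zero))       = inj₂ (suc (suc zero))
recentrePath (inj₁ (suc (suc zero))) = inj₂ (suc zero)
recentrePath (inj₂ zero)             = inj₁ zero
recentrePath (inj₂ (suc zero))       = inj₂ zero
recentrePath (inj₂ (suc (suc zero))) = inj₁ (suc zero)

recentrePath⁻¹ : PathIdx 3 → PathIdx 3
recentrePath⁻¹ (inj₁ (suc (suc zero))) = inj₁ zero
recentrePath⁻¹ (inj₂ (suc (suc zero))) = inj₁ (suc zero)
recentrePath⁻¹ (inj₂ (suc zero))       = inj₁ (suc (suc zero))
recentrePath⁻¹ (inj₁ zero)             = inj₂ zero
recentrePath⁻¹ (inj₂ zero)             = inj₂ (suc zero)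
recentrePath⁻¹ (inj₁ (suc zero))       = inj₂ (suc (suc zero))

recentrePath-inverse : ∀ k → recentrePath⁻¹ (recentrePath k) ≡ k
recentrePath-inverse (inj₁ zero)             = refl
recentrePath-inverse (inj₁ (suc zero))       = refl
recentrePath-inverse (inj₁ (suc (suc zero))) = refl
recentrePath-inverse (inj₂ zero)             = refl
recentrePath-inverse (inj₂ (suc zero))       = refl
recentrePath-inverse (inj₂ (suc (suc zero))) = refl

module _ {G : WGraph} (W : WheelSub G 0) where
  open WGraph G
  open Paths G

  private
    c : V
    c = center W
    b : Fin 3 → V
    b = branch W
    I : PathIdx 3 → List V
    I = inner W

  recentreBranch : Fin 3 → V
  recentreBranch zero             = c
  recentreBranch (suc zero)       = b zero
  recentreBranch (suc (suc zero)) = b (suc zero)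

  recentreInner : PathIdx 3 → List V
  recentreInner (inj₁ zero)             = reverse (I (inj₁ (suc (suc zero))))
  recentreInner (inj₁ (suc zero))       = I (inj₂ (suc (suc zero)))
  recentreInner (inj₁ (suc (suc zero))) = reverse (I (inj₂ (suc zero)))
  recentreInner (inj₂ zero)             = I (inj₁ zero)
  recentreInner (inj₂ (suc zero))       = I (inj₂ zero)
  recentreInner (inj₂ (suc (suc zero))) = reverse (I (inj₁ (suc zero)))

  recentreInner-∈ : ∀ k x → x ∈ recentreInner k → x ∈ I (recentrePath k)
  recentreInner-∈ (inj₁ zero)             x x∈ = Any.reverse⁻ x∈
  recentreInner-∈ (inj₁ (suc zero))       x x∈ = x∈
  recentreInner-∈ (inj₁ (suc (suc zero))) x x∈ = Any.reverse⁻ x∈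
  recentreInner-∈ (inj₂ zero)             x x∈ = x∈
  recentreInner-∈ (inj₂ (suc zero))       x x∈ = x∈
  recentreInner-∈ (inj₂ (suc (suc zero))) x x∈ = Any.reverse⁻ x∈

  recentre-orientation : ∀ k → let p = fullPath G (b (suc (suc zero))) recentreBranch recentreInner k in
    p ≡ full W (recentrePath k) ⊎ p ≡ reverse (full W (recentrePath k))
  recentre-orientation (inj₁ zero)             = inj₂ (sym (reverse-path c (I (inj₁ (suc (suc zero)))) (b (suc (suc zero)))))
  recentre-orientation (inj₁ (suc zero))       = inj₁ refl
  recentre-orientation (inj₁ (suc (suc zero))) = inj₂ (sym (reverse-path (b (suc zero)) (I (inj₂ (suc zero))) (b (suc (suc zero)))))
  recentre-orientation (inj₂ zero)             = inj₁ refl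
  recentre-orientation (inj₂ (suc zero))       = inj₁ refl
  recentre-orientation (inj₂ (suc (suc zero))) = inj₂ (sym (reverse-path c (I (inj₁ (suc zero))) (b (suc zero))))

  recentre : WheelSub G 0
  recentre .center = b (suc (suc zero))
  recentre .branch = recentreBranch
  recentre .inner  = recentreInner
  recentre .center-branch zero eq             = center-branch W (suc (suc zero)) (sym eq)
  recentre .center-branch (suc zero) eq       with () ← branch-inj W (suc (suc zero)) zero eq
  recentre .center-branch (suc (suc zero)) eq with () ← branch-inj W (suc (suc zero)) (suc zero) eq
  recentre .branch-inj zero             zero             eq = refl
  recentre .branch-inj zero             (suc zero)       eq = ⊥-elim (center-branch W zero eq)
  recentre .branch-inj zero             (suc (suc zero)) eq = ⊥-elim (center-branch W (suc zero) eq)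
  recentre .branch-inj (suc zero)       zero             eq = ⊥-elim (center-branch W zero (sym eq))
  recentre .branch-inj (suc zero)       (suc zero)       eq = refl
  recentre .branch-inj (suc zero)       (suc (suc zero)) eq with () ← branch-inj W zero (suc zero) eq
  recentre .branch-inj (suc (suc zero)) zero             eq = ⊥-elim (center-branch W (suc zero) (sym eq))
  recentre .branch-inj (suc (suc zero)) (suc zero)       eq with () ← branch-inj W (suc zero) zero eq
  recentre .branch-inj (suc (suc zero)) (suc (suc zero)) eq = refl
  recentre .paths k with recentre-orientation k
  ... | inj₁ eq = subst (IsPath G) (sym eq) (paths W (recentrePath k))
  ... | inj₂ eq = subst (IsPath G) (sym eq) (IsPath-reverse _ (paths W (recentrePath k)))
  recentre .inner-center k x x∈ = inner-branch W (recentrePath k) x (suc (suc zero)) (recentreInner-∈ k x x∈)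
  recentre .inner-branch k x zero             x∈ = inner-center W (recentrePath k) x (recentreInner-∈ k x x∈)
  recentre .inner-branch k x (suc zero)       x∈ = inner-branch W (recentrePath k) x zero (recentreInner-∈ k x x∈)
  recentre .inner-branch k x (suc (suc zero)) x∈ = inner-branch W (recentrePath k) x (suc zero) (recentreInner-∈ k x x∈)
  recentre .inner-disj k k' x x∈ x∈' = begin
      k                                    ≡⟨ recentrePath-inverse k ⟨
      recentrePath⁻¹ (recentrePath k)      ≡⟨ cong recentrePath⁻¹ (inner-disj W _ _ x (recentreInner-∈ k x x∈) (recentreInner-∈ k' x x∈')) ⟩
      recentrePath⁻¹ (recentrePath k')     ≡⟨ recentrePath-inverse k' ⟩
      k'                                   ∎
    where open ≡-Reasoning

  recentre-⊆ : _⊆W_ G recentre W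
  recentre-⊆ = ⊆W-by-paths recentre W (λ k → recentrePath k , recentre-orientation k)

  recentre-len : ∀ k → walkLen G (full recentre k) ≡ walkLen G (full W (recentrePath k))
  recentre-len k with recentre-orientation k
  ... | inj₁ eq = cong (walkLen G) eq
  ... | inj₂ eq = trans (cong (walkLen G) eq) (walkLen-reverse (full W (recentrePath k)))

  recentre-piece₀ : pieceLen recentre zero ≡ pieceLen W (suc (suc zero))
  recentre-piece₀ = trans (cong₂ _+_ (cong₂ _+_ (recentre-len (inj₁ zero)) (recentre-len (inj₂ zero))) (recentre-len (inj₁ (suc zero))))
                          (rearrange (spokeLen W (suc (suc zero))) (spokeLen W zero) (rimSegLen W (suc (suc zero))))
    where
      rearrange : ∀ x y z → x + y + z ≡ x + z + y
      rearrange = solve-∀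

  recentre-piece₁ : pieceLen recentre (suc zero) ≡ rimLen W
  recentre-piece₁ = trans (cong₂ _+_ (cong₂ _+_ (recentre-len (inj₁ (suc zero))) (recentre-len (inj₂ (suc zero)))) (recentre-len (inj₁ (suc (suc zero)))))
                          (trans (rearrange (rimSegLen W zero) (rimSegLen W (suc zero)) (rimSegLen W (suc (suc zero)))) (sym (rimLen-∑ W)))
    where
      rearrange : ∀ x y z → z + x + y ≡ x + (y + (z + 0))
      rearrange = solve-∀

  recentre-piece₂ : pieceLen recentre (suc (suc zero)) ≡ pieceLen W (suc zero)
  recentre-piece₂ = trans (cong₂ _+_ (cong₂ _+_ (recentre-len (inj₁ (suc (suc zero)))) (recentre-len (inj₂ (suc (suc zero))))) (recentre-len (inj₁ zero)))
                          (rearrange (spokeLen W (suc zero)) (rimSegLen W (suc zero)) (spokeLen W (suc (suc zero))))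
    where
      rearrange : ∀ x y z → y + x + z ≡ x + y + z
      rearrange = solve-∀

module _ (r : ℕ∞) (G : WGraph) where

  -- All pieces except possibly piece j are r-bounded, and so is the rim:
  -- the second alternative of an r-explicit generating set.
  LongPieceAt : ∀ {m} → Fin (3 + m) → WheelSub G m → Set
  LongPieceAt j W = (∀ i → i ≢ j → pieceLen W i ≤∞ r) × rimLen W ≤∞ r

  rotate-long : ∀ {m} (W : WheelSub G m) k → LongPieceAt (suc k) W → LongPieceAt (inject₁ k) (rotate W)
  rotate-long W k (short , rim) = short′ , subst (_≤∞ r) (sym (rotate-rim W)) rim
    where
      short′ : ∀ i → i ≢ inject₁ k → pieceLen (rotate W) i ≤∞ r
      short′ i i≢k = short (next i) λ eq → i≢k (next-injective i (inject₁ k) (trans eq (sym (next-inject₁ k))))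

  rotate-long-to-0 : ∀ t {m} (W : WheelSub G m) j → toℕ j ≡ t → LongPieceAt j W
    → Σ (WheelSub G m) λ W₀ → _⊆W_ G W₀ W × LongPieceAt zero W₀
  rotate-long-to-0 zero    W zero    _  long = W , ⊆W-refl W , long
  rotate-long-to-0 (suc t) W (suc k) eq long
    with rotate-long-to-0 t (rotate W) (inject₁ k) (trans (toℕ-inject₁ k) (suc-injective eq)) (rotate-long W k long)
  ... | W₀ , W₀⊆rotW , long₀ = W₀ , ⊆W-trans W₀ (rotate W) W W₀⊆rotW (rotate-⊆ W) , long₀

  -- Contraction keeps the exceptional piece at 0: its other pieces are
  -- pieces of W other than piece 0, and the rim is unchanged.
  contract-long : ∀ {m} (W : WheelSub G (suc m)) → LongPieceAt zero W → LongPieceAt zero (contract W)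
  contract-long W (short , rim) = short′ , subst (_≤∞ r) (sym (contract-rim W)) rim
    where
      short′ : ∀ i → i ≢ zero → pieceLen (contract W) i ≤∞ r
      short′ zero    0≢0 = ⊥-elim (0≢0 refl)
      short′ (suc i) _   = subst (_≤∞ r) (sym (contract-piece W i)) (short (suc (suc i)) λ ())

  -- Recentring a K₄ whose only long piece is piece 0 drops that piece and
  -- turns the short rim into a piece.
  recentre-bounded : (W : WheelSub G 0) → LongPieceAt zero W → Bounded G r (recentre W)
  recentre-bounded W (short , rim) zero             = subst (_≤∞ r) (sym (recentre-piece₀ W)) (short (suc (suc zero)) λ ())
  recentre-bounded W (short , rim) (suc zero)       = subst (_≤∞ r) (sym (recentre-piece₁ W)) rim
  recentre-bounded W (short , rim) (suc (suc zero)) = subst (_≤∞ r) (sym (recentre-piece₂ W)) (short (suc zero) λ ())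

  long-at-0-bounded : ∀ m (W : WheelSub G m) → LongPieceAt zero W → HasBoundedSubwheel r G W
  long-at-0-bounded zero    W long = 0 , recentre W , recentre-⊆ W , recentre-bounded W long
  long-at-0-bounded (suc m) W long =
    HasBoundedSubwheel-⊆ (contract W) W (contract-⊆ W) (long-at-0-bounded m (contract W) (contract-long W long))

  long-piece-bounded : ∀ {m} (W : WheelSub G m) j → LongPieceAt j W → HasBoundedSubwheel r G W
  long-piece-bounded {m} W j long with rotate-long-to-0 (toℕ j) W j refl long
  ... | W₀ , W₀⊆W , long₀ = HasBoundedSubwheel-⊆ W₀ W W₀⊆W (long-at-0-bounded m W₀ long₀)

lemma2p7 : (r : ℕ∞) (G : WGraph) (m : ℕ) (W : WheelSub G m) →
    ExplicitGen G r W →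
    ∃[ m' ] ∃[ W' ] ((_⊆W_ G {m} {m'} W' W) × Bounded G r W')
lemma2p7 r G m W (inj₁ bounded)    = m , W , ⊆W-refl W , bounded
lemma2p7 r G m W (inj₂ (j , long)) = long-piece-bounded r G W j long
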